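{- Let $(G,\Gamma,k)$ be a yes-instance of \textsc{Dilation $t$-Augmentation}, let $S$ be a minimal solution, and let $V_S$ be the set of end-points of the edges of $S$. Then $V_c\subseteq N^t_G(V_S)$.
   Context: Let $\Gamma$ be a finite undirected unweighted graph with vertex set $V$, and let $d_\Gamma(u,v)$ denote the shortest-path (hop) distance in $\Gamma$. A graph $G$ on the same vertex set $V$ is viewed as edge-weighted: each edge $(u,v)$ of $G$ has weight $d_\Gamma(u,v)$, and $d_G(u,v)$ denotes the weighted shortest-path distance in $G$. For a set $S$ of non-edges of $G$, $G+S=(V,E(G)\cup S)$ with the same weighting rule. \textsc{Dilation $t$-Augmentation}: given $(G,\Gamma,k)$, decide whether there is a set $S$ of at most $k$ non-edges of $G$ (a solution) such that $d_{G+S}(u,v)\le t\cdot d_\Gamma(u,v)$ for all $u,v\in V$; a minimal solution is an inclusion-minimal such set. $V_c$ is the set of vertices $u$ for which there exists $v$ with $(u,v)\in E(\Gamma)$ and $d_G(u,v)>t\cdot d_\Gamma(u,v)$ (vertices in adjacent conflict in $G$). For a graph $H$, a set $W\subseteq V(H)$ and $\ell\ge 0$, $N^\ell_H(W)$ is the set of vertices at hop (unweighted, i.e., ignoring edge weights) distance at most $\ell$ in $H$ from some vertex of $W$.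
   Formalization: The parameter t takes rational values. -}

module Defs where

open import Data.Nat using (ℕ; zero; suc; _+_)
open import Data.Nat.Properties using ()
open import Data.Fin using (Fin; toℕ)
open import Data.Bool using (Bool; true; false; _∧_; _∨_; if_then_else_)
open import Data.List using (List; map)
open import Data.Nat.ListAction using (sum)
open import Data.List.Base using (allFin)
open import Data.Integer using (+_)
open import Data.Rational using (ℚ; _/_; _≤_; _*_)
open import Data.Product using (Σ; _×_; ∃; ∃-syntax)
open import Relation.Binary.PropositionalEquality using (_≡_)
open import Relation.Nullary using (¬_)
import Data.Nat as N

Graph : ℕ → Set
Graph n = Fin n → Fin n → Bool

Simple : ∀ {n} → Graph n → Set
Simple {n} H = (∀ (u v : Fin n) → H u v ≡ H v u) × (∀ (u : Fin n) → H u u ≡ false)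

⟦_⟧ : ℕ → ℚ
⟦ m ⟧ = (+ m) / 1

data HopWalk {n} (H : Graph n) : Fin n → Fin n → ℕ → Set where
  here : ∀ u → HopWalk H u u 0
  step : ∀ {u v w m} → H u v ≡ true → HopWalk H v w m → HopWalk H u w (suc m)

-- Hop (shortest-path) distance: d_H(u,v) = d (if v is unreachable from u, no d qualifies,
-- i.e. the distance is infinite).
HopDist : ∀ {n} → Graph n → Fin n → Fin n → ℕ → Set
HopDist H u v d = HopWalk H u v d × (∀ m → HopWalk H u v m → d N.≤ m)

-- Weighted walks in H, where each edge (a,b) of H has weight d_Γ(a,b):
-- WWalk Γ H u v w = a walk from u to v in H of total weight w.
data WWalk {n} (Γ H : Graph n) : Fin n → Fin n → ℕ → Set where
  here : ∀ u → WWalk Γ H u u 0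
  step : ∀ {u v w d c} → H u v ≡ true → HopDist Γ u v d →
         WWalk Γ H v w c → WWalk Γ H u w (d + c)

WDistLe : ∀ {n} → Graph n → Graph n → Fin n → Fin n → ℚ → Set
WDistLe Γ H u v x = ∃[ w ] (WWalk Γ H u v w × ⟦ w ⟧ ≤ x)

_⊕_ : ∀ {n} → Graph n → Graph n → Graph n
(G ⊕ S) u v = G u v ∨ S u v

_⊆E_ : ∀ {n} → Graph n → Graph n → Set
_⊆E_ {n} S S' = ∀ (u v : Fin n) → S u v ≡ true → S' u v ≡ true

edgeCount : ∀ {n} → Graph n → ℕ
edgeCount {n} S =
  sum (map (λ u → sum (map (λ v → if (toℕ u N.<ᵇ toℕ v) ∧ S u v then 1 else 0)
                             (allFin n)))
           (allFin n))

-- d_{G+S}(u,v) ≤ t · d_Γ(u,v) for all u, v (vacuous when d_Γ(u,v) = ∞)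
Dilation : ∀ {n} → ℚ → Graph n → Graph n → Set
Dilation {n} t Γ H =
  ∀ (u v : Fin n) (d : ℕ) → HopDist Γ u v d → WDistLe Γ H u v (t * ⟦ d ⟧)

IsSolution : ∀ {n} → ℚ → Graph n → Graph n → ℕ → Graph n → Set
IsSolution {n} t G Γ k S =
  Simple S × (∀ (u v : Fin n) → S u v ≡ true → G u v ≡ false) ×
  edgeCount S N.≤ k × Dilation t Γ (G ⊕ S)

IsMinimalSolution : ∀ {n} → ℚ → Graph n → Graph n → ℕ → Graph n → Set
IsMinimalSolution t G Γ k S =
  IsSolution t G Γ k S × (∀ S' → IsSolution t G Γ k S' → S' ⊆E S → S ⊆E S')

InVc : ∀ {n} → ℚ → Graph n → Graph n → Fin n → Set
InVc t G Γ u = ∃[ v ] (Γ u v ≡ true ×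
  (∀ d → HopDist Γ u v d → ¬ WDistLe Γ G u v (t * ⟦ d ⟧)))

InVS : ∀ {n} → Graph n → Fin n → Set
InVS S x = ∃[ y ] (S x y ≡ true)

InNbhd : ∀ {n} → Graph n → ℚ → (Fin n → Set) → Fin n → Set
InNbhd H ℓ W u = ∃[ x ] (W x × ∃[ m ] (HopWalk H x u m × ⟦ m ⟧ ≤ ℓ))

{-# OPTIONS --safe #-}
module Submission where

-- Take a Γ-neighbour v of u with d_G(u,v) > t. A shortest u–v path in G + S has weight
-- at most t, so it uses an edge of S; since every edge of G joins distinct vertices and
-- so has weight at least 1, the G-prefix before the first S-edge has at most t hops and
-- ends in V_S.

open import Defs
open import Data.Nat using (ℕ; suc; _≤_; s≤s; z≤n)
open import Data.Nat.Properties using (+-mono-≤)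
open import Data.Fin using (Fin)
open import Data.Rational using (ℚ)
import Data.Integer as ℤ
import Data.Integer.Properties as ℤ
import Data.Rational as ℚ
import Data.Rational.Properties as ℚ
open import Data.Nat.Coprimality using (1-coprimeTo)
import Data.Nat.Coprimality as Coprime
open import Data.Bool using (true; false)
open import Data.Product using (_×_; _,_; proj₁; ∃-syntax)
open import Data.Sum using (_⊎_; inj₁; inj₂)
open import Data.Empty using (⊥-elim)
open import Relation.Binary.PropositionalEquality using (_≡_; _≢_; refl; sym; trans; subst)

private
  variable
    n m w : ℕ
    H : Graph n
    u v : Fin n

⟦⟧≡mkℚ : ∀ m → ⟦ m ⟧ ≡ ℚ.mkℚ (ℤ.+ m) 0 (Coprime.sym (1-coprimeTo m))
⟦⟧≡mkℚ m = ℚ.normalize-coprime (Coprime.sym (1-coprimeTo m))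

⟦⟧-mono-≤ : m ≤ w → ⟦ m ⟧ ℚ.≤ ⟦ w ⟧
⟦⟧-mono-≤ {m} {w} m≤w rewrite ⟦⟧≡mkℚ m | ⟦⟧≡mkℚ w =
  ℚ.*≤* (ℤ.*-monoʳ-≤-nonNeg (ℤ.+ 1) (ℤ.+≤+ m≤w))

Loopless : Graph n → Set
Loopless H = ∀ u → H u u ≡ false

edge⇒≢ : Loopless H → H u v ≡ true → u ≢ v
edge⇒≢ loopless Huv refl with () ← trans (sym (loopless _)) Huv

HopWalk-snoc : ∀ {a b c} → HopWalk H a b m → H b c ≡ true → HopWalk H a c (suc m)
HopWalk-snoc (here _)        Hbc = step Hbc (here _)
HopWalk-snoc (step Hav walk) Hbc = step Hav (HopWalk-snoc walk Hbc)

HopWalk-reverse : (∀ a b → H a b ≡ H b a) → HopWalk H u v m → HopWalk H v u m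
HopWalk-reverse symmetric (here _) = here _
HopWalk-reverse symmetric (step {u} {x} Hux walk) =
  HopWalk-snoc (HopWalk-reverse symmetric walk) (trans (symmetric x u) Hux)

HopWalk-≢⇒1≤length : u ≢ v → HopWalk H u v m → 1 ≤ m
HopWalk-≢⇒1≤length u≢v (here _)   = ⊥-elim (u≢v refl)
HopWalk-≢⇒1≤length u≢v (step _ _) = s≤s z≤n

edge⇒HopDist-1 : Loopless H → H u v ≡ true → HopDist H u v 1
edge⇒HopDist-1 {v = v} loopless Huv =
  step Huv (here v) , λ _ → HopWalk-≢⇒1≤length (edge⇒≢ loopless Huv)

WWalk-⊕-split : ∀ {Γ G S : Graph n} → Loopless G → WWalk Γ (G ⊕ S) u v w →
  WWalk Γ G u v w ⊎ ∃[ x ] (InVS S x × ∃[ m ] (HopWalk G u x m × m ≤ w))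
WWalk-⊕-split loopless (here u) = inj₁ (here u)
WWalk-⊕-split {G = G} loopless (step {u} {x} G∨S-ux dist rest) with G u x in Gux
... | false = inj₂ (u , (x , G∨S-ux) , 0 , here u , z≤n)
... | true with WWalk-⊕-split loopless rest
...   | inj₁ restG = inj₁ (step Gux dist restG)
...   | inj₂ (y , y∈VS , m , prefix , m≤c) =
  inj₂ (y , y∈VS , suc m , step Gux prefix ,
        +-mono-≤ (HopWalk-≢⇒1≤length (edge⇒≢ loopless Gux) (proj₁ dist)) m≤c)

lemma23 : ∀ {n} (t : ℚ) (G Γ : Graph n) (k : ℕ) (S : Graph n) →
    Simple G → Simple Γ → IsMinimalSolution t G Γ k S →
    ∀ (u : Fin n) → InVc t G Γ u → InNbhd G t (InVS S) u
lemma23 t G Γ k S (G-symmetric , G-loopless) (_ , Γ-loopless) ((_ , _ , _ , dilation) , _)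
        u (v , Γuv , far-in-G) = reach-VS (dilation u v 1 dist-uv)
  where
  dist-uv : HopDist Γ u v 1
  dist-uv = edge⇒HopDist-1 Γ-loopless Γuv

  reach-VS : WDistLe Γ (G ⊕ S) u v (t ℚ.* ⟦ 1 ⟧) → InNbhd G t (InVS S) u
  reach-VS (w , walk , w≤t) with WWalk-⊕-split G-loopless walk
  ... | inj₁ walk-in-G = ⊥-elim (far-in-G 1 dist-uv (w , walk-in-G , w≤t))
  ... | inj₂ (x , x∈VS , m , prefix , m≤w) =
    x , x∈VS , m , HopWalk-reverse G-symmetric prefix ,
    ℚ.≤-trans (⟦⟧-mono-≤ m≤w) (subst (⟦ w ⟧ ℚ.≤_) (ℚ.*-identityʳ t) w≤t)
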